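{- Let $G=(V,E)$ be a graph with $|V|=n$, non-negative edge weights $w:E\to\mathbb{R}_{\ge0}$, and $c:V\to\mathbb{N}$ with $c_v\le d(v)$ for all $v$. Consider the following algorithm. For each $v$ let $H(v)$ be a set of $c_v$ heaviest edges incident on $v$ (ties broken arbitrarily). Let $T=\{e=(u,v)\in E: e\in H(u)\text{ and }e\in H(v)\}$, and let $E_2$ be the set of edges $e=(u,v)$ lying in exactly one of $H(u),H(v)$; orient such an edge from $u$ to $v$ if $e\notin H(u)$ and $e\in H(v)$. Label the vertices by distinct integers $0,\dots,n-1$ and let $k=\lceil\log_2 n\rceil$. For $r=1,\dots,k$ let $A_r$ be the set of edges of $E_2$ directed from $u$ to $v$ such that the labels of $u$ and $v$ agree in their $r-1$ least significant binary digits and the $r$-th least significant digit is $0$ for $u$ and $1$ for $v$; let $B_r$ be defined in the same way but with the $r$-th digit $1$ for $u$ and $0$ for $v$. Output the set of maximum total weight among $T,A_1,\dots,A_k,B_1,\dots,B_k$. Then the output is a feasible PDBEP solution, and its weight is at least $\mathrm{OPT}/(2+2\lceil\log_2 n\rceil)$, where $\mathrm{OPT}$ is the maximum total weight of a feasible PDBEP solution.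
   Context: Weighted PDBEP: given $G=(V,E)$, $c:V\to\mathbb{N}$ and non-negative edge weights $w$, a set $E'\subseteq E$ is feasible if for every $(u,v)\in E'$, $d'_u\le c_u$ or $d'_v\le c_v$, with $d'_x$ the degree of $x$ in $(V,E')$; the goal is to maximize $w(E')=\sum_{e\in E'}w(e)$. $d(v)$ is the degree of $v$ in $G$.
   Formalization: The edge weights are non-negative rationals instead of non-negative reals. -}

module Defs where

open import Data.Nat using (ℕ; zero; suc; _+_; _*_; _≤_; _<_)
open import Data.Nat.DivMod using (_%_; _/_)
open import Data.Nat.Logarithm using (⌈log₂_⌉)
open import Data.Fin using (Fin; zero; suc; toℕ; _≟_)
open import Data.Bool using (Bool; true; false; _∧_; _∨_; not; if_then_else_)
open import Data.Integer using (+_)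
open import Data.Rational using (ℚ; 0ℚ) renaming (_+_ to _+ℚ_; _/_ to _/ℚ_; _*_ to _*ℚ_; _≤_ to _≤ℚ_)
open import Data.Product using (_×_; Σ; _,_)
open import Data.Sum using (_⊎_)
open import Relation.Binary.PropositionalEquality using (_≡_; _≢_)
open import Relation.Nullary.Decidable using (⌊_⌋)
import Data.Nat as ℕ

-- Finite (simple, undirected) graphs on vertex set Fin n with m edges.
-- Edge e has endpoints src e and tgt e (the orientation is irrelevant).

record Graph (n m : ℕ) : Set where
  field
    src tgt  : Fin m → Fin n
    loopless : ∀ e → src e ≢ tgt e
    simple   : ∀ e e' →
               ((src e ≡ src e') × (tgt e ≡ tgt e'))
                 ⊎ ((src e ≡ tgt e') × (tgt e ≡ src e')) → e ≡ e'
open Graph public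

EdgeSet : ℕ → Set
EdgeSet m = Fin m → Bool

allEdges : ∀ {m} → EdgeSet m
allEdges _ = true

count : ∀ {m} → (Fin m → Bool) → ℕ
count {zero}  f = 0
count {suc m} f = (if f zero then 1 else 0) + count (λ i → f (suc i))

sumℚ : ∀ {m} → (Fin m → ℚ) → ℚ
sumℚ {zero}  f = 0ℚ
sumℚ {suc m} f = f zero +ℚ sumℚ (λ i → f (suc i))

incident : ∀ {n m} → Graph n m → Fin n → Fin m → Bool
incident G v e = ⌊ src G e ≟ v ⌋ ∨ ⌊ tgt G e ≟ v ⌋

deg : ∀ {n m} → Graph n m → EdgeSet m → Fin n → ℕ
deg G S v = count (λ e → S e ∧ incident G v e)

d : ∀ {n m} → Graph n m → Fin n → ℕ
d G v = deg G allEdges v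

weight : ∀ {m} → (Fin m → ℚ) → EdgeSet m → ℚ
weight w S = sumℚ (λ e → if S e then w e else 0ℚ)

Feasible : ∀ {n m} → Graph n m → (Fin n → ℕ) → EdgeSet m → Set
Feasible G c S = ∀ e → S e ≡ true →
  (deg G S (src G e) ≤ c (src G e)) ⊎ (deg G S (tgt G e) ≤ c (tgt G e))

IsHeaviest : ∀ {n m} → Graph n m → (Fin m → ℚ) → (Fin n → ℕ) →
             (Fin n → EdgeSet m) → Set
IsHeaviest G w c H = ∀ v →
  (∀ e → H v e ≡ true → incident G v e ≡ true)
  × (count (H v) ≡ c v)
  × (∀ e e' → H v e ≡ true → incident G v e' ≡ true → H v e' ≡ false →
       w e' ≤ℚ w e)

Tset : ∀ {n m} → Graph n m → (Fin n → EdgeSet m) → EdgeSet m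
Tset G H e = H (src G e) e ∧ H (tgt G e) e

-- binary digits: bit i a is the (i+1)-th least significant digit of a
bit : ℕ → ℕ → ℕ
bit zero    a = a % 2
bit (suc i) a = bit i (a / 2)

agreeLow : ℕ → ℕ → ℕ → Bool
agreeLow zero    a b = true
agreeLow (suc i) a b = ⌊ a % 2 ℕ.≟ b % 2 ⌋ ∧ agreeLow i (a / 2) (b / 2)

-- for r = i + 1: labels agree in the r-1 lowest digits, and the r-th
-- lowest digit is x for the tail and y for the head
digitCond : ℕ → ℕ → ℕ → ℕ → ℕ → Bool
digitCond i x y a b =
  agreeLow i a b ∧ ⌊ bit i a ℕ.≟ x ⌋ ∧ ⌊ bit i b ℕ.≟ y ⌋

dirSet : ∀ {n m} → Graph n m → (Fin n → EdgeSet m) → (Fin n → ℕ) →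
         ℕ → ℕ → ℕ → EdgeSet m
dirSet G H label i x y e =
  (not (H s e) ∧ H t e ∧ digitCond i x y (label s) (label t))
  ∨ (not (H t e) ∧ H s e ∧ digitCond i x y (label t) (label s))
  where
    s = src G e
    t = tgt G e

-- A_r and B_r with r = toℕ i + 1, r ∈ {1,…,k}
Aset Bset : ∀ {n m k} → Graph n m → (Fin n → EdgeSet m) → (Fin n → ℕ) →
            Fin k → EdgeSet m
Aset G H label i = dirSet G H label (toℕ i) 0 1
Bset G H label i = dirSet G H label (toℕ i) 1 0

data Choice (k : ℕ) : Set where
  chooseT : Choice k
  chooseA : Fin k → Choice k
  chooseB : Fin k → Choice k

candidate : ∀ {n m k} → Graph n m → (Fin n → EdgeSet m) → (Fin n → ℕ) →
            Choice k → EdgeSet m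
candidate G H label chooseT     = Tset G H
candidate G H label (chooseA i) = Aset G H label i
candidate G H label (chooseB i) = Bset G H label i

logK : ℕ → ℕ
logK n = ⌈log₂ n ⌉

factor : ℕ → ℚ
factor k = (+ (2 + 2 * k)) /ℚ 1

-- Feasibility: every candidate edge e has an endpoint v such that all candidate
-- edges at v lie in H(v), so the candidate has degree at most |H(v)| = c v
-- there.  For T either endpoint works; for A_r, B_r it is the head v, because
-- the tail of a candidate edge has r-th digit different from that of v.
--
-- Approximation: give each edge of an optimal F to an endpoint x that is light
-- in F.  The edges given to x are at most c x edges at x, so they weigh at
-- most w(H(x)) (exchange argument).  Hence OPT ≤ Σ_x w(H(x)), which counts the
-- edges of T twice and every other edge of E₂ once.  An edge of E₂ from u to
-- v lies in A_r or B_r for the lowest binary digit r in which the labels of u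
-- and v differ, so OPT ≤ 2 w(T) + Σ_r (w(A_r) + w(B_r)) ≤ (2 + 2k) w(out).

{-# OPTIONS --safe #-}
module Submission where

open import Defs
open import Algebra.Bundles using (CommutativeRing)
import Algebra.Properties.CommutativeMonoid.Sum as CommutativeMonoidSum
import Algebra.Properties.Semiring.Mult as SemiringMult
open import Data.Bool using (Bool; true; false; _∧_; _∨_; not; if_then_else_)
import Data.Bool.Properties as Boolₚ
open import Data.Fin as Fin using (Fin; zero; suc; toℕ)
import Data.Fin.Properties as Finₚ
import Data.Integer as ℤ
import Data.Integer.Properties as ℤₚ
open import Data.Nat as ℕ using (ℕ; zero; suc; z≤n; s≤s; _≤_; _<_; _+_; _*_; _^_; _≤?_; ⌊_/2⌋; ⌈_/2⌉)
import Data.Nat.Coprimality as Coprimality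
open import Data.Nat.DivMod using (_%_; _/_; m%n<n; m≡m%n+[m/n]*n; m<n*o⇒m/o<n)
open import Data.Nat.Induction using (<-wellFounded)
open import Data.Nat.Logarithm.Core using (⌈log2⌉)
import Data.Nat.Properties as ℕₚ
open import Data.Product using (Σ; ∃₂; _×_; _,_; proj₁; proj₂)
open import Data.Rational using (ℚ; 0ℚ; 1ℚ; mkℚ; toℚᵘ) renaming (_≤_ to _≤ℚ_; _*_ to _*ℚ_; _+_ to _+ℚ_; _/_ to _/ℚ_; _⊔_ to _⊔ℚ_)
import Data.Rational.Properties as ℚₚ
import Data.Rational.Unnormalised as ℚᵘ
import Data.Rational.Unnormalised.Properties as ℚᵘₚ
open import Data.Sum using (_⊎_; inj₁; inj₂)
open import Function using (_∘_)
open import Induction.WellFounded using (Acc; acc)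
open import Relation.Binary.PropositionalEquality using (_≡_; _≢_; refl; sym; trans; cong; cong₂; subst; subst₂; module ≡-Reasoning)
open import Relation.Nullary using (Dec; yes; no; ¬_; contradiction)
open import Relation.Nullary.Decidable using (⌊_⌋)

open SemiringMult (CommutativeRing.semiring ℚₚ.+-*-commutativeRing)
  using (×-homo-+; ×-assocˡ; ×-assoc-*) renaming (_×_ to _·_)
open CommutativeMonoidSum ℚₚ.+-0-commutativeMonoid using (sum; sum-replicate; sum-replicate-zero; ∑-distrib-+; ∑-comm)

∧-true⁻ : ∀ {a b} → a ∧ b ≡ true → a ≡ true × b ≡ true
∧-true⁻ {true} b≡true = refl , b≡true

∧-true⁺ : ∀ {a b} → a ≡ true → b ≡ true → a ∧ b ≡ true
∧-true⁺ refl b≡true = b≡true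

∨-true⁻ : ∀ {a b} → a ∨ b ≡ true → a ≡ true ⊎ b ≡ true
∨-true⁻ {true}  _      = inj₁ refl
∨-true⁻ {false} b≡true = inj₂ b≡true

∨-true⁺ : ∀ {a b} → a ≡ true ⊎ b ≡ true → a ∨ b ≡ true
∨-true⁺         (inj₁ refl)   = refl
∨-true⁺ {true}  (inj₂ _)      = refl
∨-true⁺ {false} (inj₂ b≡true) = b≡true

¬∧∧-true⁻ : ∀ {a b d} → not a ∧ b ∧ d ≡ true → a ≡ false × b ≡ true × d ≡ true
¬∧∧-true⁻ {false} {true} d≡true = refl , refl , d≡true

¬∧∧-true⁺ : ∀ {a b d} → a ≡ false → b ≡ true → d ≡ true → not a ∧ b ∧ d ≡ true
¬∧∧-true⁺ refl refl d≡true = d≡true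

isYes⁻ : ∀ {P : Set} (p? : Dec P) → ⌊ p? ⌋ ≡ true → P
isYes⁻ (yes p) _ = p

isYes⁺ : ∀ {P : Set} (p? : Dec P) → P → ⌊ p? ⌋ ≡ true
isYes⁺ (yes _) _ = refl
isYes⁺ (no ¬p) p = contradiction p ¬p

isYes-false⁺ : ∀ {P : Set} (p? : Dec P) → ¬ P → ⌊ p? ⌋ ≡ false
isYes-false⁺ (yes p) ¬p = contradiction p ¬p
isYes-false⁺ (no _)  _  = refl

infix 8 _onlyIf_
_onlyIf_ : ℚ → Bool → ℚ
p onlyIf b = if b then p else 0ℚ

onlyIf-split : ∀ a b p → p onlyIf a ≡ p onlyIf (a ∧ b) +ℚ p onlyIf (a ∧ not b)
onlyIf-split true  true  p = sym (ℚₚ.+-identityʳ p)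
onlyIf-split true  false p = sym (ℚₚ.+-identityˡ p)
onlyIf-split false b     p = sym (ℚₚ.+-identityʳ 0ℚ)

sumℚ≡sum : ∀ {k} (f : Fin k → ℚ) → sumℚ f ≡ sum f
sumℚ≡sum {zero}  f = refl
sumℚ≡sum {suc k} f = cong (f zero +ℚ_) (sumℚ≡sum (λ i → f (suc i)))

sumℚ-cong : ∀ {k} {f g : Fin k → ℚ} → (∀ i → f i ≡ g i) → sumℚ f ≡ sumℚ g
sumℚ-cong {zero}  f≡g = refl
sumℚ-cong {suc k} f≡g = cong₂ _+ℚ_ (f≡g zero) (sumℚ-cong (λ i → f≡g (suc i)))

sumℚ-+ : ∀ {k} (f g : Fin k → ℚ) → sumℚ (λ i → f i +ℚ g i) ≡ sumℚ f +ℚ sumℚ g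
sumℚ-+ f g = begin
  sumℚ (λ i → f i +ℚ g i) ≡⟨ sumℚ≡sum (λ i → f i +ℚ g i) ⟩
  sum (λ i → f i +ℚ g i)  ≡⟨ ∑-distrib-+ f g ⟩
  sum f +ℚ sum g          ≡⟨ sym (cong₂ _+ℚ_ (sumℚ≡sum f) (sumℚ≡sum g)) ⟩
  sumℚ f +ℚ sumℚ g        ∎
  where open ≡-Reasoning

sumℚ-comm : ∀ {k l} (f : Fin k → Fin l → ℚ) →
            sumℚ (λ i → sumℚ (λ j → f i j)) ≡ sumℚ (λ j → sumℚ (λ i → f i j))
sumℚ-comm f = begin
  sumℚ (λ i → sumℚ (λ j → f i j)) ≡⟨ double-sum f ⟩
  sum (λ i → sum (λ j → f i j))   ≡⟨ ∑-comm f ⟩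
  sum (λ j → sum (λ i → f i j))   ≡⟨ sym (double-sum (λ j i → f i j)) ⟩
  sumℚ (λ j → sumℚ (λ i → f i j)) ∎
  where
  open ≡-Reasoning
  double-sum : ∀ {k l} (g : Fin k → Fin l → ℚ) →
               sumℚ (λ i → sumℚ (g i)) ≡ sum (λ i → sum (g i))
  double-sum g = trans (sumℚ-cong (λ i → sumℚ≡sum (g i))) (sumℚ≡sum (λ i → sum (g i)))

sumℚ-const : ∀ k (p : ℚ) → sumℚ {k} (λ _ → p) ≡ k · p
sumℚ-const k p = trans (sumℚ≡sum {k} (λ _ → p)) (sum-replicate k)

sumℚ-zero : ∀ k → sumℚ {k} (λ _ → 0ℚ) ≡ 0ℚ
sumℚ-zero k = trans (sumℚ≡sum {k} (λ _ → 0ℚ)) (sum-replicate-zero k)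

sumℚ-single : ∀ {k} (f : Fin k → ℚ) (p : Fin k) →
              (∀ i → i ≢ p → f i ≡ 0ℚ) → sumℚ f ≡ f p
sumℚ-single {suc k} f zero    off = begin
  f zero +ℚ sumℚ (λ i → f (suc i)) ≡⟨ cong (f zero +ℚ_) (sumℚ-cong (λ i → off (suc i) λ ())) ⟩
  f zero +ℚ sumℚ {k} (λ _ → 0ℚ)    ≡⟨ cong (f zero +ℚ_) (sumℚ-zero k) ⟩
  f zero +ℚ 0ℚ                     ≡⟨ ℚₚ.+-identityʳ (f zero) ⟩
  f zero                           ∎
  where open ≡-Reasoning
sumℚ-single {suc k} f (suc p) off = begin
  f zero +ℚ sumℚ (λ i → f (suc i)) ≡⟨ cong₂ _+ℚ_ (off zero λ ()) (sumℚ-single (λ i → f (suc i)) p off′) ⟩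
  0ℚ +ℚ f (suc p)                  ≡⟨ ℚₚ.+-identityˡ (f (suc p)) ⟩
  f (suc p)                        ∎
  where
  open ≡-Reasoning
  off′ : ∀ i → i ≢ p → f (suc i) ≡ 0ℚ
  off′ i i≢p = off (suc i) (λ eq → i≢p (Finₚ.suc-injective eq))

sumℚ-pair : ∀ {k} (f : Fin k → ℚ) {p q : Fin k} → p ≢ q →
            (∀ i → i ≢ p → i ≢ q → f i ≡ 0ℚ) → sumℚ f ≡ f p +ℚ f q
sumℚ-pair f {p} {q} p≢q off = begin
  sumℚ f                               ≡⟨ sumℚ-cong (λ i → onlyIf-split true (at-p i) (f i)) ⟩
  sumℚ (λ i → on-p i +ℚ off-p i)       ≡⟨ sumℚ-+ on-p off-p ⟩
  sumℚ on-p +ℚ sumℚ off-p              ≡⟨ cong₂ _+ℚ_ (sumℚ-single on-p p on-p-off) (sumℚ-single off-p q off-p-off) ⟩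
  f p onlyIf at-p p +ℚ f q onlyIf not (at-p q)
    ≡⟨ cong₂ _+ℚ_ (cong (f p onlyIf_) (isYes⁺ (p Fin.≟ p) refl))
                  (cong (λ b → f q onlyIf not b) (isYes-false⁺ (q Fin.≟ p) (λ q≡p → p≢q (sym q≡p)))) ⟩
  f p +ℚ f q                           ∎
  where
  open ≡-Reasoning
  at-p : Fin _ → Bool
  at-p i = ⌊ i Fin.≟ p ⌋
  on-p off-p : Fin _ → ℚ
  on-p  i = f i onlyIf at-p i
  off-p i = f i onlyIf not (at-p i)
  on-p-off : ∀ i → i ≢ p → on-p i ≡ 0ℚ
  on-p-off i i≢p = cong (f i onlyIf_) (isYes-false⁺ (i Fin.≟ p) i≢p)
  off-p-off : ∀ i → i ≢ q → off-p i ≡ 0ℚ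
  off-p-off i i≢q with i Fin.≟ p
  ... | yes _   = refl
  ... | no i≢p  = off i i≢p i≢q

sumℚ-mono : ∀ {k} {f g : Fin k → ℚ} → (∀ i → f i ≤ℚ g i) → sumℚ f ≤ℚ sumℚ g
sumℚ-mono {zero}  f≤g = ℚₚ.≤-refl
sumℚ-mono {suc k} f≤g = ℚₚ.+-mono-≤ (f≤g zero) (sumℚ-mono (λ i → f≤g (suc i)))

p≤p+q : ∀ p {q} → 0ℚ ≤ℚ q → p ≤ℚ p +ℚ q
p≤p+q p {q} 0≤q = subst (_≤ℚ p +ℚ q) (ℚₚ.+-identityʳ p) (ℚₚ.+-monoʳ-≤ p 0≤q)

p≤q+p : ∀ p {q} → 0ℚ ≤ℚ q → p ≤ℚ q +ℚ p
p≤q+p p {q} 0≤q = subst (_≤ℚ q +ℚ p) (ℚₚ.+-identityˡ p) (ℚₚ.+-monoˡ-≤ p 0≤q)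

+-nonneg : ∀ {p q} → 0ℚ ≤ℚ p → 0ℚ ≤ℚ q → 0ℚ ≤ℚ p +ℚ q
+-nonneg {p} 0≤p 0≤q = ℚₚ.≤-trans 0≤p (p≤p+q p 0≤q)

sumℚ-nonneg : ∀ {k} {f : Fin k → ℚ} → (∀ i → 0ℚ ≤ℚ f i) → 0ℚ ≤ℚ sumℚ f
sumℚ-nonneg {zero}  0≤f = ℚₚ.≤-refl
sumℚ-nonneg {suc k} 0≤f = +-nonneg (0≤f zero) (sumℚ-nonneg (λ i → 0≤f (suc i)))

term≤sumℚ : ∀ {k} {f : Fin k → ℚ} → (∀ i → 0ℚ ≤ℚ f i) → ∀ i → f i ≤ℚ sumℚ f
term≤sumℚ {suc k} {f} 0≤f zero    = p≤p+q (f zero) (sumℚ-nonneg (λ i → 0≤f (suc i)))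
term≤sumℚ {suc k} {f} 0≤f (suc i) =
  ℚₚ.≤-trans (term≤sumℚ (λ j → 0≤f (suc j)) i) (p≤q+p _ (0≤f zero))

·-nonneg : ∀ k {p} → 0ℚ ≤ℚ p → 0ℚ ≤ℚ k · p
·-nonneg zero    0≤p = ℚₚ.≤-refl
·-nonneg (suc k) 0≤p = +-nonneg 0≤p (·-nonneg k 0≤p)

·-monoˡ-≤ : ∀ {k l} p → 0ℚ ≤ℚ p → k ≤ l → k · p ≤ℚ l · p
·-monoˡ-≤ {l = l} p 0≤p z≤n     = ·-nonneg l 0≤p
·-monoˡ-≤         p 0≤p (s≤s k≤l) = ℚₚ.+-monoʳ-≤ p (·-monoˡ-≤ p 0≤p k≤l)

-- ℚ-addition normalises by a gcd that does not reduce for a variable n, so the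
-- sum is compared in ℚᵘ, where it is a plain fraction.
+[1+n]/1≡1+n/1 : ∀ n → ℤ.+ suc n /ℚ 1 ≡ 1ℚ +ℚ (ℤ.+ n /ℚ 1)
+[1+n]/1≡1+n/1 n = ℚₚ.toℚᵘ-injective
  (ℚᵘₚ.≃-trans unnormalised (ℚᵘₚ.≃-sym (ℚₚ.toℚᵘ-homo-+ 1ℚ (ℤ.+ n /ℚ 1))))
  where
  +n/1≡ : ∀ n → ℤ.+ n /ℚ 1 ≡ mkℚ (ℤ.+ n) 0 (Coprimality.sym (Coprimality.1-coprimeTo n))
  +n/1≡ n = ℚₚ.normalize-coprime (Coprimality.sym (Coprimality.1-coprimeTo n))
  unnormalised : toℚᵘ (ℤ.+ suc n /ℚ 1) ℚᵘ.≃ (toℚᵘ 1ℚ ℚᵘ.+ toℚᵘ (ℤ.+ n /ℚ 1))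
  unnormalised rewrite +n/1≡ n | +n/1≡ (suc n) | ℕₚ.*-identityʳ n | ℤₚ.+◃n≡+n n = ℚᵘ.*≡* refl

+n/1≡n·1 : ∀ n → ℤ.+ n /ℚ 1 ≡ n · 1ℚ
+n/1≡n·1 zero    = refl
+n/1≡n·1 (suc n) = trans (+[1+n]/1≡1+n/1 n) (cong (1ℚ +ℚ_) (+n/1≡n·1 n))

factor-*-≡ : ∀ k p → factor k *ℚ p ≡ (p +ℚ p) +ℚ k · (p +ℚ p)
factor-*-≡ k p = begin
  factor k *ℚ p              ≡⟨ cong (_*ℚ p) (+n/1≡n·1 (2 + 2 * k)) ⟩
  ((2 + 2 * k) · 1ℚ) *ℚ p    ≡⟨ ×-assoc-* (2 + 2 * k) 1ℚ p ⟩
  (2 + 2 * k) · (1ℚ *ℚ p)    ≡⟨ cong ((2 + 2 * k) ·_) (ℚₚ.*-identityˡ p) ⟩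
  (2 + 2 * k) · p            ≡⟨ ×-homo-+ p 2 (2 * k) ⟩
  2 · p +ℚ (2 * k) · p       ≡⟨ cong (λ l → 2 · p +ℚ l · p) (ℕₚ.*-comm 2 k) ⟩
  2 · p +ℚ (k * 2) · p       ≡⟨ cong (2 · p +ℚ_) (sym (×-assocˡ p k 2)) ⟩
  2 · p +ℚ k · (2 · p)       ≡⟨ cong (λ q → q +ℚ k · q) (cong (p +ℚ_) (ℚₚ.+-identityʳ p)) ⟩
  (p +ℚ p) +ℚ k · (p +ℚ p)   ∎
  where open ≡-Reasoning

infixl 7 _∩_ _∖_
_∩_ _∖_ : ∀ {m} → EdgeSet m → EdgeSet m → EdgeSet m
(S ∩ Y) e = S e ∧ Y e
(S ∖ Y) e = S e ∧ not (Y e)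

onlyIf-nonneg : ∀ b {p} → 0ℚ ≤ℚ p → 0ℚ ≤ℚ p onlyIf b
onlyIf-nonneg true  0≤p = 0≤p
onlyIf-nonneg false _   = ℚₚ.≤-refl

onlyIf-mono : ∀ b {p q} → (b ≡ true → p ≤ℚ q) → p onlyIf b ≤ℚ q onlyIf b
onlyIf-mono true  p≤q = p≤q refl
onlyIf-mono false _   = ℚₚ.≤-refl

≤-onlyIf-+ : ∀ a b {p} → 0ℚ ≤ℚ p → a ≡ true ⊎ b ≡ true → p ≤ℚ p onlyIf a +ℚ p onlyIf b
≤-onlyIf-+ true  b     {p} 0≤p _ = p≤p+q p (onlyIf-nonneg b 0≤p)
≤-onlyIf-+ false true  {p} _   _ = p≤q+p p ℚₚ.≤-refl
≤-onlyIf-+ false false _ (inj₁ ())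
≤-onlyIf-+ false false _ (inj₂ ())

onlyIf-pair-≤ : ∀ a b {p r} → 0ℚ ≤ℚ p → 0ℚ ≤ℚ r → (a ≢ b → p ≤ℚ r) →
                p onlyIf a +ℚ p onlyIf b ≤ℚ (p onlyIf (a ∧ b) +ℚ p onlyIf (a ∧ b)) +ℚ r
onlyIf-pair-≤ true  true  {p} _ 0≤r _ = p≤p+q (p +ℚ p) 0≤r
onlyIf-pair-≤ true  false {p} {r} _ _ p≤r =
  subst₂ _≤ℚ_ (sym (ℚₚ.+-identityʳ p)) (sym (ℚₚ.+-identityˡ r)) (p≤r λ ())
onlyIf-pair-≤ false true  {p} {r} _ _ p≤r =
  subst₂ _≤ℚ_ (sym (ℚₚ.+-identityˡ p)) (sym (ℚₚ.+-identityˡ r)) (p≤r λ ())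
onlyIf-pair-≤ false false _ 0≤r _ = p≤p+q (0ℚ +ℚ 0ℚ) 0≤r

count-cong : ∀ {m} {f g : Fin m → Bool} → (∀ e → f e ≡ g e) → count f ≡ count g
count-cong {zero}  f≡g = refl
count-cong {suc m} f≡g =
  cong₂ _+_ (cong (λ b → if b then 1 else 0) (f≡g zero)) (count-cong (λ e → f≡g (suc e)))

count-mono : ∀ {m} {f g : Fin m → Bool} → (∀ e → f e ≡ true → g e ≡ true) → count f ≤ count g
count-mono {zero}          f⊆g = z≤n
count-mono {suc m} {f} {g} f⊆g = step (f zero) (g zero) (f⊆g zero) (count-mono (λ e → f⊆g (suc e)))
  where
  step : ∀ a b {k l} → (a ≡ true → b ≡ true) → k ≤ l →
         (if a then 1 else 0) + k ≤ (if b then 1 else 0) + l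
  step true  true  _   k≤l = s≤s k≤l
  step true  false a⇒b k≤l with () ← a⇒b refl
  step false true  _   k≤l = ℕₚ.m≤n⇒m≤1+n k≤l
  step false false _   k≤l = k≤l

count-none : ∀ {m} {f : Fin m → Bool} → (∀ e → f e ≡ false) → count f ≡ 0
count-none {zero}      none = refl
count-none {suc m} {f} none rewrite none zero = count-none (λ e → none (suc e))

count-split : ∀ {m} (S Y : EdgeSet m) → count S ≡ count (S ∩ Y) + count (S ∖ Y)
count-split {zero}  S Y = refl
count-split {suc m} S Y =
  trans (cong ((if S zero then 1 else 0) +_) (count-split (λ e → S (suc e)) (λ e → Y (suc e))))
        (step (S zero) (Y zero) _ _)
  where
  step : ∀ a b k l → (if a then 1 else 0) + (k + l) ≡
         ((if a ∧ b then 1 else 0) + k) + ((if a ∧ not b then 1 else 0) + l)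
  step true  true  k l = refl
  step true  false k l = sym (ℕₚ.+-suc k l)
  step false b     k l = refl

count-∖-≤ : ∀ {m} (S Y : EdgeSet m) → count S ≤ count Y → count (S ∖ Y) ≤ count (Y ∖ S)
count-∖-≤ S Y |S|≤|Y| = ℕₚ.+-cancelˡ-≤ (count (S ∩ Y)) _ _ (begin
  count (S ∩ Y) + count (S ∖ Y) ≡⟨ sym (count-split S Y) ⟩
  count S                       ≤⟨ |S|≤|Y| ⟩
  count Y                       ≡⟨ count-split Y S ⟩
  count (Y ∩ S) + count (Y ∖ S) ≡⟨ cong (_+ count (Y ∖ S)) (count-cong (λ e → Boolₚ.∧-comm (Y e) (S e))) ⟩
  count (S ∩ Y) + count (Y ∖ S) ∎)
  where open ℕₚ.≤-Reasoning

weight-cong : ∀ {m} (w : Fin m → ℚ) {S Y : EdgeSet m} → (∀ e → S e ≡ Y e) → weight w S ≡ weight w Y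
weight-cong w S≡Y = sumℚ-cong (λ e → cong (w e onlyIf_) (S≡Y e))

weight-mono : ∀ {m} {w v : Fin m → ℚ} (S : EdgeSet m) → (∀ e → S e ≡ true → w e ≤ℚ v e) →
              weight w S ≤ℚ weight v S
weight-mono S w≤v = sumℚ-mono (λ e → onlyIf-mono (S e) (w≤v e))

weight-split : ∀ {m} (w : Fin m → ℚ) (S Y : EdgeSet m) →
               weight w S ≡ weight w (S ∩ Y) +ℚ weight w (S ∖ Y)
weight-split w S Y = trans (sumℚ-cong (λ e → onlyIf-split (S e) (Y e) (w e)))
                           (sumℚ-+ (λ e → w e onlyIf (S ∩ Y) e) (λ e → w e onlyIf (S ∖ Y) e))

weight-const : ∀ {m} (p : ℚ) (S : EdgeSet m) → weight (λ _ → p) S ≡ count S · p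
weight-const {zero}  p S = refl
weight-const {suc m} p S = step (S zero) (weight-const p (λ e → S (suc e)))
  where
  step : ∀ b {q k} → q ≡ k · p → p onlyIf b +ℚ q ≡ ((if b then 1 else 0) + k) · p
  step true  q≡ = cong (p +ℚ_) q≡
  step false q≡ = trans (ℚₚ.+-identityˡ _) q≡

fibre : ∀ {m n} → EdgeSet m → (Fin m → Fin n) → Fin n → EdgeSet m
fibre S f x e = S e ∧ ⌊ f e Fin.≟ x ⌋

weight-fibres : ∀ {m n} (w : Fin m → ℚ) (S : EdgeSet m) (f : Fin m → Fin n) →
                weight w S ≡ sumℚ (λ x → weight w (fibre S f x))
weight-fibres w S f = sym (begin
  sumℚ (λ x → sumℚ (λ e → w e onlyIf fibre S f x e))
    ≡⟨ sumℚ-comm (λ x e → w e onlyIf fibre S f x e) ⟩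
  sumℚ (λ e → sumℚ (λ x → w e onlyIf fibre S f x e))
    ≡⟨ sumℚ-cong (λ e → sumℚ-single _ (f e) (off e)) ⟩
  sumℚ (λ e → w e onlyIf (S e ∧ ⌊ f e Fin.≟ f e ⌋))
    ≡⟨ sumℚ-cong (λ e → cong (λ b → w e onlyIf (S e ∧ b)) (isYes⁺ (f e Fin.≟ f e) refl)) ⟩
  sumℚ (λ e → w e onlyIf (S e ∧ true))
    ≡⟨ weight-cong w (λ e → Boolₚ.∧-identityʳ (S e)) ⟩
  weight w S ∎)
  where
  open ≡-Reasoning
  off : ∀ e x → x ≢ f e → w e onlyIf fibre S f x e ≡ 0ℚ
  off e x x≢fe = cong (w e onlyIf_) (begin
    S e ∧ ⌊ f e Fin.≟ x ⌋ ≡⟨ cong (S e ∧_) (isYes-false⁺ (f e Fin.≟ x) (λ fe≡x → x≢fe (sym fe≡x))) ⟩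
    S e ∧ false           ≡⟨ Boolₚ.∧-zeroʳ (S e) ⟩
    false                 ∎)

-- The exchange argument

maxOn : ∀ {m} → (Fin m → ℚ) → EdgeSet m → ℚ
maxOn {zero}  w S = 0ℚ
maxOn {suc m} w S = w zero onlyIf S zero ⊔ℚ maxOn (w ∘ suc) (S ∘ suc)

maxOn-nonneg : ∀ {m} (w : Fin m → ℚ) S → 0ℚ ≤ℚ maxOn w S
maxOn-nonneg {zero}  w S = ℚₚ.≤-refl
maxOn-nonneg {suc m} w S =
  ℚₚ.≤-trans (maxOn-nonneg (w ∘ suc) (S ∘ suc)) (ℚₚ.p≤q⊔p (w zero onlyIf S zero) _)

≤-maxOn : ∀ {m} (w : Fin m → ℚ) S e → S e ≡ true → w e ≤ℚ maxOn w S
≤-maxOn {suc m} w S zero    e∈S =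
  ℚₚ.≤-trans (ℚₚ.≤-reflexive (cong (w zero onlyIf_) (sym e∈S))) (ℚₚ.p≤p⊔q _ _)
≤-maxOn {suc m} w S (suc e) e∈S =
  ℚₚ.≤-trans (≤-maxOn (w ∘ suc) (S ∘ suc) e e∈S) (ℚₚ.p≤q⊔p (w zero onlyIf S zero) _)

maxOn-lub : ∀ {m} (w : Fin m → ℚ) S {p} → 0ℚ ≤ℚ p →
            (∀ e → S e ≡ true → w e ≤ℚ p) → maxOn w S ≤ℚ p
maxOn-lub {zero}  w S 0≤p _   = 0≤p
maxOn-lub {suc m} w S 0≤p S≤p =
  ℚₚ.⊔-lub (head (S zero) (S≤p zero)) (maxOn-lub (w ∘ suc) (S ∘ suc) 0≤p (S≤p ∘ suc))
  where
  head : ∀ b → (b ≡ true → w zero ≤ℚ _) → w zero onlyIf b ≤ℚ _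
  head true  w≤p = w≤p refl
  head false _   = 0≤p

weight-≤-exchange : ∀ {m} (w : Fin m → ℚ) (S Y : EdgeSet m) → (∀ e → 0ℚ ≤ℚ w e) →
  count S ≤ count Y →
  (∀ e e' → Y e ≡ true → S e' ≡ true → Y e' ≡ false → w e' ≤ℚ w e) →
  weight w S ≤ℚ weight w Y
weight-≤-exchange w S Y 0≤w |S|≤|Y| Y-heavier = begin
  weight w S                            ≡⟨ weight-split w S Y ⟩
  weight w (S ∩ Y) +ℚ weight w (S ∖ Y)  ≡⟨ cong (_+ℚ weight w (S ∖ Y)) (weight-cong w ∩-comm) ⟩
  weight w (Y ∩ S) +ℚ weight w (S ∖ Y)  ≤⟨ ℚₚ.+-monoʳ-≤ (weight w (Y ∩ S)) S∖Y≤Y∖S ⟩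
  weight w (Y ∩ S) +ℚ weight w (Y ∖ S)  ≡⟨ sym (weight-split w Y S) ⟩
  weight w Y                            ∎
  where
  open ℚₚ.≤-Reasoning
  ∩-comm : ∀ e → (S ∩ Y) e ≡ (Y ∩ S) e
  ∩-comm e = Boolₚ.∧-comm (S e) (Y e)
  t = maxOn w (S ∖ Y)
  t≤Y∖S : ∀ e → (Y ∖ S) e ≡ true → t ≤ℚ w e
  t≤Y∖S e e∈Y∖S = maxOn-lub w (S ∖ Y) (0≤w e) λ e' e'∈S∖Y →
    let (e'∈S , e'∉Y) = ∧-true⁻ e'∈S∖Y in
    Y-heavier e e' (proj₁ (∧-true⁻ e∈Y∖S)) e'∈S (Boolₚ.not-injective e'∉Y)
  S∖Y≤Y∖S : weight w (S ∖ Y) ≤ℚ weight w (Y ∖ S)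
  S∖Y≤Y∖S = begin
    weight w (S ∖ Y)          ≤⟨ weight-mono (S ∖ Y) (≤-maxOn w (S ∖ Y)) ⟩
    weight (λ _ → t) (S ∖ Y)  ≡⟨ weight-const t (S ∖ Y) ⟩
    count (S ∖ Y) · t         ≤⟨ ·-monoˡ-≤ t (maxOn-nonneg w (S ∖ Y)) (count-∖-≤ S Y |S|≤|Y|) ⟩
    count (Y ∖ S) · t         ≡⟨ weight-const t (Y ∖ S) ⟨
    weight (λ _ → t) (Y ∖ S)  ≤⟨ weight-mono (Y ∖ S) t≤Y∖S ⟩
    weight w (Y ∖ S)          ∎

-- Binary labels

n≤2^⌈log2⌉n : ∀ n (rec : Acc _<_ n) → n ≤ 2 ^ ⌈log2⌉ n rec
n≤2^⌈log2⌉n zero                _        = z≤n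
n≤2^⌈log2⌉n (suc zero)          _        = s≤s z≤n
n≤2^⌈log2⌉n (suc (suc n)) (acc rs) = begin
  2 + n                        ≡⟨ ℕₚ.⌊n/2⌋+⌈n/2⌉≡n (2 + n) ⟨
  ⌊ 2 + n /2⌋ + ⌈ 2 + n /2⌉    ≤⟨ ℕₚ.+-monoˡ-≤ ⌈ 2 + n /2⌉ (ℕₚ.⌊n/2⌋≤⌈n/2⌉ (2 + n)) ⟩
  ⌈ 2 + n /2⌉ + ⌈ 2 + n /2⌉    ≤⟨ ℕₚ.+-mono-≤ half≤ half≤ ⟩
  2 ^ K + 2 ^ K                ≡⟨ cong (2 ^ K +_) (ℕₚ.+-identityʳ (2 ^ K)) ⟨
  2 ^ suc K                    ∎
  where
  open ℕₚ.≤-Reasoning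
  K = ⌈log2⌉ (suc ⌈ n /2⌉) (rs (ℕₚ.⌈n/2⌉<n n))
  half≤ : ⌈ 2 + n /2⌉ ≤ 2 ^ K
  half≤ = n≤2^⌈log2⌉n (suc ⌈ n /2⌉) (rs (ℕₚ.⌈n/2⌉<n n))

bit<2 : ∀ i a → bit i a < 2
bit<2 zero    a = m%n<n a 2
bit<2 (suc i) a = bit<2 i (a / 2)

digitCond⁻ : ∀ i x y a b → digitCond i x y a b ≡ true →
             agreeLow i a b ≡ true × bit i a ≡ x × bit i b ≡ y
digitCond⁻ i x y a b cond =
  let (agree , digits) = ∧-true⁻ cond ; (a-digit , b-digit) = ∧-true⁻ digits in
  agree , isYes⁻ (bit i a ℕ.≟ x) a-digit , isYes⁻ (bit i b ℕ.≟ y) b-digit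

digitCond⁺ : ∀ i x y a b → agreeLow i a b ≡ true → bit i a ≡ x → bit i b ≡ y →
             digitCond i x y a b ≡ true
digitCond⁺ i x y a b agree a-digit b-digit =
  ∧-true⁺ agree (∧-true⁺ (isYes⁺ (bit i a ℕ.≟ x) a-digit) (isYes⁺ (bit i b ℕ.≟ y) b-digit))

lowest-differing-bit : ∀ k a b → a < 2 ^ k → b < 2 ^ k → a ≢ b →
  Σ (Fin k) λ i → agreeLow (toℕ i) a b ≡ true × bit (toℕ i) a ≢ bit (toℕ i) b
lowest-differing-bit zero    zero    zero    _         _         a≢b = contradiction refl a≢b
lowest-differing-bit zero    (suc a) b       (s≤s ())  _         _
lowest-differing-bit zero    zero    (suc b) _         (s≤s ())  _
lowest-differing-bit (suc k) a       b       a<2^[1+k] b<2^[1+k] a≢b with a % 2 ℕ.≟ b % 2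
... | no  a%2≢b%2 = zero , refl , a%2≢b%2
... | yes a%2≡b%2
  with lowest-differing-bit k (a / 2) (b / 2) (halve a<2^[1+k]) (halve b<2^[1+k]) a/2≢b/2
  where
  halve : ∀ {c} → c < 2 ^ suc k → c / 2 < 2 ^ k
  halve {c} c< = m<n*o⇒m/o<n (subst (c <_) (ℕₚ.*-comm 2 (2 ^ k)) c<)
  a/2≢b/2 : a / 2 ≢ b / 2
  a/2≢b/2 a/2≡b/2 = a≢b (begin
    a                  ≡⟨ m≡m%n+[m/n]*n a 2 ⟩
    a % 2 + a / 2 * 2  ≡⟨ cong₂ (λ r q → r + q * 2) a%2≡b%2 a/2≡b/2 ⟩
    b % 2 + b / 2 * 2  ≡⟨ m≡m%n+[m/n]*n b 2 ⟨
    b                  ∎)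
    where open ≡-Reasoning
... | i , agree , differ = suc i , ∧-true⁺ (isYes⁺ (a % 2 ℕ.≟ b % 2) a%2≡b%2) agree , differ

distinct-bits : ∀ {p q} → p < 2 → q < 2 → p ≢ q → (p ≡ 0 × q ≡ 1) ⊎ (p ≡ 1 × q ≡ 0)
distinct-bits {0}           {0}           _                _                p≢q = contradiction refl p≢q
distinct-bits {0}           {1}           _                _                _   = inj₁ (refl , refl)
distinct-bits {1}           {0}           _                _                _   = inj₂ (refl , refl)
distinct-bits {1}           {1}           _                _                p≢q = contradiction refl p≢q
distinct-bits {suc (suc _)} {_}           (s≤s (s≤s ()))   _                _
distinct-bits {_}           {suc (suc _)} _                (s≤s (s≤s ()))   _

module _ {n m} (G : Graph n m) where

  Ends : Fin m → Fin n → Fin n → Set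
  Ends e u v = (src G e ≡ u × tgt G e ≡ v) ⊎ (src G e ≡ v × tgt G e ≡ u)

  incident⁻ : ∀ {v e} → incident G v e ≡ true → src G e ≡ v ⊎ tgt G e ≡ v
  incident⁻ {v} {e} v∈e with ∨-true⁻ v∈e
  ... | inj₁ at-src = inj₁ (isYes⁻ (src G e Fin.≟ v) at-src)
  ... | inj₂ at-tgt = inj₂ (isYes⁻ (tgt G e Fin.≟ v) at-tgt)

  incident⁺ : ∀ {v e} → src G e ≡ v ⊎ tgt G e ≡ v → incident G v e ≡ true
  incident⁺ {v} {e} (inj₁ at-src) = ∨-true⁺ (inj₁ (isYes⁺ (src G e Fin.≟ v) at-src))
  incident⁺ {v} {e} (inj₂ at-tgt) = ∨-true⁺ (inj₂ (isYes⁺ (tgt G e Fin.≟ v) at-tgt))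

  Ends-head : ∀ {e u v} → Ends e u v → src G e ≡ v ⊎ tgt G e ≡ v
  Ends-head (inj₁ (_ , tgt≡v)) = inj₂ tgt≡v
  Ends-head (inj₂ (src≡v , _)) = inj₁ src≡v

  Ends-distinct : ∀ {e u v} → Ends e u v → u ≢ v
  Ends-distinct {e} (inj₁ (refl , refl)) = loopless G e
  Ends-distinct {e} (inj₂ (refl , refl)) = λ tgt≡src → loopless G e (sym tgt≡src)

  Ends-incident : ∀ {e u v z} → Ends e u v → incident G z e ≡ true → u ≡ z ⊎ v ≡ z
  Ends-incident (inj₁ (refl , refl)) z∈e = incident⁻ z∈e
  Ends-incident (inj₂ (refl , refl)) z∈e with incident⁻ z∈e
  ... | inj₁ src≡z = inj₂ src≡z
  ... | inj₂ tgt≡z = inj₁ tgt≡z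

module Algorithm {n m} (G : Graph n m) (w : Fin m → ℚ) (c : Fin n → ℕ)
                 (H : Fin n → EdgeSet m) (H-heaviest : IsHeaviest G w c H) where

  H-incident : ∀ v e → H v e ≡ true → incident G v e ≡ true
  H-incident v = proj₁ (H-heaviest v)

  count-H : ∀ v → count (H v) ≡ c v
  count-H v = proj₁ (proj₂ (H-heaviest v))

  H-heavier : ∀ v e e' → H v e ≡ true → incident G v e' ≡ true → H v e' ≡ false → w e' ≤ℚ w e
  H-heavier v = proj₂ (proj₂ (H-heaviest v))

  WithinH : EdgeSet m → Fin n → Set
  WithinH S v = ∀ e → S e ≡ true → incident G v e ≡ true → H v e ≡ true

  deg≤c : ∀ S v → WithinH S v → deg G S v ≤ c v
  deg≤c S v S⊆H = ℕₚ.≤-trans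
    (count-mono (λ e e∈S∩v → let (e∈S , v∈e) = ∧-true⁻ e∈S∩v in S⊆H e e∈S v∈e))
    (ℕₚ.≤-reflexive (count-H v))

  feasible-if-WithinH-at-endpoint : ∀ S →
    (∀ e → S e ≡ true → Σ (Fin n) λ v → (src G e ≡ v ⊎ tgt G e ≡ v) × WithinH S v) →
    Feasible G c S
  feasible-if-WithinH-at-endpoint S within e e∈S with within e e∈S
  ... | v , inj₁ refl , S⊆H = inj₁ (deg≤c S v S⊆H)
  ... | v , inj₂ refl , S⊆H = inj₂ (deg≤c S v S⊆H)

  Tset-WithinH : ∀ v → WithinH (Tset G H) v
  Tset-WithinH v e e∈T v∈e with incident⁻ G v∈e
  ... | inj₁ refl = proj₁ (∧-true⁻ e∈T)
  ... | inj₂ refl = proj₂ (∧-true⁻ e∈T)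

  Tset-feasible : Feasible G c (Tset G H)
  Tset-feasible = feasible-if-WithinH-at-endpoint (Tset G H)
    (λ e _ → src G e , inj₁ refl , Tset-WithinH (src G e))

  module Directed (label : Fin n → ℕ) (i x y : ℕ) where

    D : EdgeSet m
    D = dirSet G H label i x y

    head-and-digits : ∀ {e u v} → not (H u e) ∧ H v e ∧ digitCond i x y (label u) (label v) ≡ true →
                      H v e ≡ true × bit i (label u) ≡ x × bit i (label v) ≡ y
    head-and-digits {e} {u} {v} tail-head-cond =
      let (_ , v∈H , cond) = ¬∧∧-true⁻ {H u e} tail-head-cond
          (_ , u-digit , v-digit) = digitCond⁻ i x y (label u) (label v) cond
      in v∈H , u-digit , v-digit

    dirSet⁻ : ∀ {e} → D e ≡ true → ∃₂ λ u v →
      Ends G e u v × H v e ≡ true × bit i (label u) ≡ x × bit i (label v) ≡ y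
    dirSet⁻ {e} e∈D with ∨-true⁻ e∈D
    ... | inj₁ forward  = src G e , tgt G e , inj₁ (refl , refl) , head-and-digits forward
    ... | inj₂ backward = tgt G e , src G e , inj₂ (refl , refl) , head-and-digits backward

    dirSet⁺ : ∀ {e u v} → Ends G e u v → H u e ≡ false → H v e ≡ true →
              digitCond i x y (label u) (label v) ≡ true → D e ≡ true
    dirSet⁺ (inj₁ (refl , refl)) u∉H v∈H cond = ∨-true⁺ (inj₁ (¬∧∧-true⁺ u∉H v∈H cond))
    dirSet⁺ (inj₂ (refl , refl)) u∉H v∈H cond = ∨-true⁺ (inj₂ (¬∧∧-true⁺ u∉H v∈H cond))

    dirSet-WithinH : x ≢ y → ∀ v → bit i (label v) ≡ y → WithinH D v
    dirSet-WithinH x≢y v v-digit e e∈D v∈e with dirSet⁻ e∈D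
    ... | u , v′ , ends , v′∈H , u-digit , _ with Ends-incident G ends v∈e
    ... | inj₁ refl = contradiction (trans (sym u-digit) v-digit) x≢y
    ... | inj₂ refl = v′∈H

    dirSet-feasible : x ≢ y → Feasible G c D
    dirSet-feasible x≢y = feasible-if-WithinH-at-endpoint D λ e e∈D →
      let (u , v , ends , _ , _ , v-digit) = dirSet⁻ e∈D in
      v , Ends-head G ends , dirSet-WithinH x≢y v v-digit

  candidate-feasible : ∀ {k} label (j : Choice k) → Feasible G c (candidate G H label j)
  candidate-feasible label chooseT     = Tset-feasible
  candidate-feasible label (chooseA i) = Directed.dirSet-feasible label (toℕ i) 0 1 (λ ())
  candidate-feasible label (chooseB i) = Directed.dirSet-feasible label (toℕ i) 1 0 (λ ())

  H-off-endpoints : ∀ e x → x ≢ src G e → x ≢ tgt G e → H x e ≡ false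
  H-off-endpoints e x x≢src x≢tgt =
    Boolₚ.¬-not λ x∈H → not-endpoint (incident⁻ G (H-incident x e x∈H))
    where
    not-endpoint : src G e ≡ x ⊎ tgt G e ≡ x → _
    not-endpoint (inj₁ src≡x) = x≢src (sym src≡x)
    not-endpoint (inj₂ tgt≡x) = x≢tgt (sym tgt≡x)

  sum-weight-H : sumℚ (λ x → weight w (H x)) ≡
                 sumℚ (λ e → w e onlyIf H (src G e) e +ℚ w e onlyIf H (tgt G e) e)
  sum-weight-H = trans (sumℚ-comm (λ x e → w e onlyIf H x e)) (sumℚ-cong λ e →
    sumℚ-pair (λ x → w e onlyIf H x e) (loopless G e)
              (λ x x≢src x≢tgt → cong (w e onlyIf_) (H-off-endpoints e x x≢src x≢tgt)))

  E₂-orientation : ∀ e → H (src G e) e ≢ H (tgt G e) e →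
                   ∃₂ λ u v → Ends G e u v × H u e ≡ false × H v e ≡ true
  E₂-orientation e differ with H (src G e) e in src∈H | H (tgt G e) e in tgt∈H
  ... | false | true  = src G e , tgt G e , inj₁ (refl , refl) , src∈H , tgt∈H
  ... | true  | false = tgt G e , src G e , inj₂ (refl , refl) , tgt∈H , src∈H
  ... | true  | true  = contradiction refl differ
  ... | false | false = contradiction refl differ

  module LightEnds (F : EdgeSet m) (F-feasible : Feasible G c F) where

    lightEnd : Fin m → Fin n
    lightEnd e with deg G F (src G e) ≤? c (src G e)
    ... | yes _ = src G e
    ... | no  _ = tgt G e

    lightEnd-endpoint : ∀ e → src G e ≡ lightEnd e ⊎ tgt G e ≡ lightEnd e
    lightEnd-endpoint e with deg G F (src G e) ≤? c (src G e)
    ... | yes _ = inj₁ refl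
    ... | no  _ = inj₂ refl

    lightEnd-light : ∀ e → F e ≡ true → deg G F (lightEnd e) ≤ c (lightEnd e)
    lightEnd-light e e∈F with deg G F (src G e) ≤? c (src G e) | F-feasible e e∈F
    ... | yes src-light | _              = src-light
    ... | no  src-heavy | inj₁ src-light = contradiction src-light src-heavy
    ... | no  _         | inj₂ tgt-light = tgt-light

    fibre⁻ : ∀ {x e} → fibre F lightEnd x e ≡ true → F e ≡ true × lightEnd e ≡ x
    fibre⁻ {x} {e} e∈fibre =
      let (e∈F , at-x) = ∧-true⁻ e∈fibre in e∈F , isYes⁻ (lightEnd e Fin.≟ x) at-x

    lightEnd-incident : ∀ x e → fibre F lightEnd x e ≡ true → incident G x e ≡ true
    lightEnd-incident x e e∈fibre with lightEnd-endpoint e | proj₂ (fibre⁻ e∈fibre)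
    ... | inj₁ src≡end | refl = incident⁺ G (inj₁ src≡end)
    ... | inj₂ tgt≡end | refl = incident⁺ G (inj₂ tgt≡end)

    count-fibre≤c : ∀ x → count (fibre F lightEnd x) ≤ c x
    count-fibre≤c x with deg G F x ≤? c x
    ... | yes x-light = ℕₚ.≤-trans (count-mono fibre⊆F∩x) x-light
      where
      fibre⊆F∩x : ∀ e → fibre F lightEnd x e ≡ true → F e ∧ incident G x e ≡ true
      fibre⊆F∩x e e∈fibre = ∧-true⁺ (proj₁ (fibre⁻ e∈fibre)) (lightEnd-incident x e e∈fibre)
    ... | no  x-heavy = subst (_≤ c x) (sym (count-none fibre-empty)) z≤n
      where
      fibre-empty : ∀ e → fibre F lightEnd x e ≡ false
      fibre-empty e = Boolₚ.¬-not λ e∈fibre → let (e∈F , end≡x) = fibre⁻ e∈fibre in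
        x-heavy (subst (λ z → deg G F z ≤ c z) end≡x (lightEnd-light e e∈F))

  feasible-weight-≤-sum-H : (∀ e → 0ℚ ≤ℚ w e) → ∀ F → Feasible G c F →
                            weight w F ≤ℚ sumℚ (λ x → weight w (H x))
  feasible-weight-≤-sum-H 0≤w F F-feasible = begin
    weight w F                                 ≡⟨ weight-fibres w F lightEnd ⟩
    sumℚ (λ x → weight w (fibre F lightEnd x))  ≤⟨ sumℚ-mono fibre≤H ⟩
    sumℚ (λ x → weight w (H x))                ∎
    where
    open ℚₚ.≤-Reasoning
    open LightEnds F F-feasible
    fibre≤H : ∀ x → weight w (fibre F lightEnd x) ≤ℚ weight w (H x)
    fibre≤H x = weight-≤-exchange w (fibre F lightEnd x) (H x) 0≤w
      (ℕₚ.≤-trans (count-fibre≤c x) (ℕₚ.≤-reflexive (sym (count-H x))))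
      (λ e e' e∈H e'∈fibre → H-heavier x e e' e∈H (lightEnd-incident x e' e'∈fibre))

  module Labelled (0≤w : ∀ e → 0ℚ ≤ℚ w e) (label : Fin n → ℕ)
                  (label-injective : ∀ u v → label u ≡ label v → u ≡ v)
                  (label<n : ∀ v → label v < n) where

    k : ℕ
    k = logK n

    T : EdgeSet m
    T = Tset G H

    A B : Fin k → EdgeSet m
    A = Aset G H label
    B = Bset G H label

    label<2^k : ∀ v → label v < 2 ^ k
    label<2^k v = ℕₚ.<-≤-trans (label<n v) (n≤2^⌈log2⌉n n (<-wellFounded n))

    E₂-in-A-or-B : ∀ {e u v} → Ends G e u v → H u e ≡ false → H v e ≡ true →
                   Σ (Fin k) λ i → A i e ≡ true ⊎ B i e ≡ true
    E₂-in-A-or-B {e} {u} {v} ends u∉H v∈H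
      with lowest-differing-bit k (label u) (label v) (label<2^k u) (label<2^k v)
                                (λ same → Ends-distinct G ends (label-injective u v same))
    ... | i , agree , differ
      with distinct-bits (bit<2 (toℕ i) (label u)) (bit<2 (toℕ i) (label v)) differ
    ... | inj₁ (u0 , v1) = i , inj₁ (Directed.dirSet⁺ label (toℕ i) 0 1 ends u∉H v∈H
                                       (digitCond⁺ (toℕ i) 0 1 (label u) (label v) agree u0 v1))
    ... | inj₂ (u1 , v0) = i , inj₂ (Directed.dirSet⁺ label (toℕ i) 1 0 ends u∉H v∈H
                                       (digitCond⁺ (toℕ i) 1 0 (label u) (label v) agree u1 v0))

    spread-term : Fin m → Fin k → ℚ
    spread-term e i = w e onlyIf A i e +ℚ w e onlyIf B i e

    spread : Fin m → ℚ
    spread e = sumℚ (spread-term e)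

    spread-term-nonneg : ∀ e i → 0ℚ ≤ℚ spread-term e i
    spread-term-nonneg e i = +-nonneg (onlyIf-nonneg (A i e) (0≤w e)) (onlyIf-nonneg (B i e) (0≤w e))

    E₂-weight-≤-spread : ∀ {e u v} → Ends G e u v → H u e ≡ false → H v e ≡ true → w e ≤ℚ spread e
    E₂-weight-≤-spread {e} ends u∉H v∈H with E₂-in-A-or-B ends u∉H v∈H
    ... | i , in-A-or-B = ℚₚ.≤-trans (≤-onlyIf-+ (A i e) (B i e) (0≤w e) in-A-or-B)
                                     (term≤sumℚ (spread-term-nonneg e) i)

    edge-bound : ∀ e → w e onlyIf H (src G e) e +ℚ w e onlyIf H (tgt G e) e ≤ℚ
                       (w e onlyIf T e +ℚ w e onlyIf T e) +ℚ spread e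
    edge-bound e = onlyIf-pair-≤ (H (src G e) e) (H (tgt G e) e) (0≤w e)
                                 (sumℚ-nonneg (spread-term-nonneg e)) one-sided
      where
      one-sided : H (src G e) e ≢ H (tgt G e) e → w e ≤ℚ spread e
      one-sided differ = let (u , v , ends , u∉H , v∈H) = E₂-orientation e differ in
                         E₂-weight-≤-spread ends u∉H v∈H

    sum-weight-H-≤ : sumℚ (λ x → weight w (H x)) ≤ℚ
      (weight w T +ℚ weight w T) +ℚ sumℚ (λ i → weight w (A i) +ℚ weight w (B i))
    sum-weight-H-≤ = begin
      sumℚ (λ x → weight w (H x))
        ≡⟨ sum-weight-H ⟩
      sumℚ (λ e → w e onlyIf H (src G e) e +ℚ w e onlyIf H (tgt G e) e)
        ≤⟨ sumℚ-mono edge-bound ⟩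
      sumℚ (λ e → (wT e +ℚ wT e) +ℚ spread e)
        ≡⟨ sumℚ-+ (λ e → wT e +ℚ wT e) spread ⟩
      sumℚ (λ e → wT e +ℚ wT e) +ℚ sumℚ spread
        ≡⟨ cong₂ _+ℚ_ (sumℚ-+ wT wT) sum-spread ⟩
      (weight w T +ℚ weight w T) +ℚ sumℚ (λ i → weight w (A i) +ℚ weight w (B i)) ∎
      where
      open ℚₚ.≤-Reasoning
      wT : Fin m → ℚ
      wT e = w e onlyIf T e
      sum-spread : sumℚ spread ≡ sumℚ (λ i → weight w (A i) +ℚ weight w (B i))
      sum-spread = trans (sumℚ-comm spread-term)
                         (sumℚ-cong (λ i → sumℚ-+ (λ e → w e onlyIf A i e) (λ e → w e onlyIf B i e)))

    approximation : (out : Choice k) →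
      ((j : Choice k) → weight w (candidate G H label j) ≤ℚ weight w (candidate G H label out)) →
      ∀ F → Feasible G c F → weight w F ≤ℚ factor k *ℚ weight w (candidate G H label out)
    approximation out out-best F F-feasible = begin
      weight w F                                     ≤⟨ feasible-weight-≤-sum-H 0≤w F F-feasible ⟩
      sumℚ (λ x → weight w (H x))                    ≤⟨ sum-weight-H-≤ ⟩
      (weight w T +ℚ weight w T) +ℚ sumℚ (λ i → weight w (A i) +ℚ weight w (B i))
        ≤⟨ ℚₚ.+-mono-≤ (ℚₚ.+-mono-≤ (out-best chooseT) (out-best chooseT))
                       (sumℚ-mono (λ i → ℚₚ.+-mono-≤ (out-best (chooseA i)) (out-best (chooseB i)))) ⟩
      (M +ℚ M) +ℚ sumℚ {k} (λ _ → M +ℚ M)            ≡⟨ cong ((M +ℚ M) +ℚ_) (sumℚ-const k (M +ℚ M)) ⟩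
      (M +ℚ M) +ℚ k · (M +ℚ M)                       ≡⟨ factor-*-≡ k M ⟨
      factor k *ℚ M                                  ∎
      where
      open ℚₚ.≤-Reasoning
      M = weight w (candidate G H label out)

theorem4 : ∀ {n m} (G : Graph n m) (w : Fin m → ℚ) (c : Fin n → ℕ) →
    (∀ e → 0ℚ ≤ℚ w e) →
    (∀ v → c v ≤ d G v) →
    (H : Fin n → EdgeSet m) → IsHeaviest G w c H →
    (label : Fin n → ℕ) → (∀ u v → label u ≡ label v → u ≡ v) → (∀ v → label v < n) →
    (out : Choice (logK n)) →
    ((j : Choice (logK n)) → weight w (candidate G H label j) ≤ℚ weight w (candidate G H label out)) →
    Feasible G c (candidate G H label out)
    × (∀ F → Feasible G c F →
         weight w F ≤ℚ factor (logK n) *ℚ weight w (candidate G H label out))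
-- c v ≤ d(v) is what makes a valid H exist.
theorem4 G w c 0≤w _ H H-heaviest label label-injective label<n out out-best =
  candidate-feasible label out , Labelled.approximation 0≤w label label-injective label<n out out-best
  where open Algorithm G w c H H-heaviest
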